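{- Let $n\ge0$ be an integer, $\beta$ a complex number, and $G_n^\beta=U_nE^{n\beta}U_n^{ -1}$ acting on the space $\mathcal P_n$ of complex polynomials of degree at most $n$. Then for every $p=0,1,\dots,n$, $$G_n^\beta x^p=\sum_{m=0}^{n}\binom{ -n\beta+p}{m}\binom{n\beta+n-p}{n-m}x^m .$$
   Context: The Euler polynomials $A_k(x)$ are defined by $\frac{A_k(x)}{(1-x)^{k+1}}=\sum_{m\ge0}m^kx^m$, with $A_0=1$. $U_n$ is the linear operator on $\mathcal P_n$ with $U_n x^p=\frac1{n!}(1-x)^{n-p}A_p(x)$, $p=0,\dots,n$ (invertible, with $U_n^{ -1}x^p=(x)_p[x+1]_{n-p}$, where $(\varphi)_k$, $[\varphi]_k$ are falling and rising factorials). $E^{c}f(x)=f(x+c)$. $\binom{c}{k}=c(c-1)\cdots(c-k+1)/k!$ for complex $c$. -}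

module Defs where

open import Level using (Level; _⊔_) renaming (suc to lsuc)
open import Algebra.Bundles using (CommutativeRing)
open import Data.Nat as ℕ using (ℕ; zero; suc; _∸_)
open import Data.Nat.Base using (_!)
open import Relation.Nullary using (¬_; yes; no)

-- A field of characteristic zero (stands in for ℂ, which agda-stdlib lacks).
-- _⁻¹ is total; it is only specified on nonzero elements.
-- image of a natural number in a ring: n ↦ 1 + ... + 1
natR : ∀ {c ℓ} (R : CommutativeRing c ℓ) → ℕ → CommutativeRing.Carrier R
natR R zero    = CommutativeRing.0# R
natR R (suc n) = CommutativeRing._+_ R (CommutativeRing.1# R) (natR R n)

record CharZeroField (c ℓ : Level) : Set (lsuc (c ⊔ ℓ)) where
  field
    commutativeRing : CommutativeRing c ℓ
  open CommutativeRing commutativeRing public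
  field
    _⁻¹      : Carrier → Carrier
    inverseʳ : ∀ x → ¬ (x ≈ 0#) → x * (x ⁻¹) ≈ 1#
    charZero : ∀ n → ¬ (natR commutativeRing (suc n) ≈ 0#)

module Poly {c ℓ : Level} (F : CharZeroField c ℓ) where
  open CharZeroField F

  nat : ℕ → Carrier
  nat = natR commutativeRing

  _−_ : Carrier → Carrier → Carrier
  x − y = x + (- y)

  pow : Carrier → ℕ → Carrier
  pow x zero    = 1#
  pow x (suc k) = x * pow x k

  Σ< : ℕ → (ℕ → Carrier) → Carrier
  Σ< zero    f = 0#
  Σ< (suc n) f = Σ< n f + f n

  Π< : ℕ → (ℕ → Carrier) → Carrier
  Π< zero    f = 1#
  Π< (suc n) f = Π< n f * f n

  binom : Carrier → ℕ → Carrier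
  binom a k = Π< k (λ i → a − nat i) * (nat (k !) ⁻¹)

  -- formal power series / polynomials as coefficient sequences
  Ser : Set c
  Ser = ℕ → Carrier

  _≋_ : Ser → Ser → Set ℓ
  f ≋ g = ∀ m → f m ≈ g m

  const : Carrier → Ser
  const a zero    = a
  const a (suc m) = 0#

  mono : ℕ → Ser
  mono p m with p ℕ.≟ m
  ... | yes _ = 1#
  ... | no  _ = 0#

  X : Ser
  X = mono 1

  _⊕_ : Ser → Ser → Ser
  (f ⊕ g) m = f m + g m

  ⊝_ : Ser → Ser
  (⊝ f) m = - f m

  scale : Carrier → Ser → Ser
  scale a f m = a * f m

  _⊛_ : Ser → Ser → Ser
  (f ⊛ g) m = Σ< (suc m) (λ i → f i * g (m ∸ i))

  powS : Ser → ℕ → Ser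
  powS f zero    = const 1#
  powS f (suc k) = f ⊛ powS f k

  ΣS< : ℕ → (ℕ → Ser) → Ser
  ΣS< n F m = Σ< n (λ i → F i m)

  ΠS< : ℕ → (ℕ → Ser) → Ser
  ΠS< zero    F = const 1#
  ΠS< (suc n) F = ΠS< n F ⊛ F n

  oneMinusX : Ser
  oneMinusX = const 1# ⊕ (⊝ X)

  -- Euler polynomial: A_k(x) = (1-x)^{k+1} Σ_{m≥0} m^k x^m  (product of power series)
  A : ℕ → Ser
  A k = powS oneMinusX (suc k) ⊛ (λ m → pow (nat m) k)

  falling : ℕ → Ser
  falling p = ΠS< p (λ i → X ⊕ const (- nat i))

  rising1 : ℕ → Ser
  rising1 q = ΠS< q (λ i → X ⊕ const (nat (suc i)))

  -- U_n on P_n, extended linearly from U_n x^p = (1/n!) (1-x)^{n-p} A_p(x)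
  U : ℕ → Ser → Ser
  U n f = ΣS< (suc n) (λ p → scale (f p * (nat (n !) ⁻¹)) (powS oneMinusX (n ∸ p) ⊛ A p))

  -- U_n^{-1} on P_n, extended linearly from U_n^{-1} x^p = (x)_p [x+1]_{n-p}
  Uinv : ℕ → Ser → Ser
  Uinv n f = ΣS< (suc n) (λ p → scale (f p) (falling p ⊛ rising1 (n ∸ p)))

  E : Carrier → ℕ → Ser → Ser
  E a n f = ΣS< (suc n) (λ j → scale (f j) (powS (X ⊕ const a) j))

  G : ℕ → Carrier → Ser → Ser
  G n β f = U n (E (nat n * β) n (Uinv n f))
  open CharZeroField F public using (Carrier; _+_; _*_; -_)

module Submission where

-- Polynomials are coefficient sequences; we read everything through the
-- values at the points 0, 1, 2, ….  Writing c = nβ and B = c + n - p: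
--   • U_n f = (1/n!) (1-x)^{n+1} Σ_j f(j) x^j, since the Euler polynomial
--     satisfies A_p = (1-x)^{p+1} Σ_j j^p x^j            (U-as-series);
--   • U_n⁻¹ x^p = (x)_p [x+1]_{n-p}, so E^c U_n⁻¹ x^p takes the value
--     (j+c)_p [j+c+1]_{n-p} = (j+B)_n at x = j           (shifted-values);
--   • the x^m-coefficient of (1-x)^{n+1} Σ_j (j+B)_n x^j is
--     C(n,m) (n-B)_m (B)_{n-m}, by induction on n using Pascal's rule for
--     falling factorials                                    (keySeries-coeff);
--   • dividing by n! = C(n,m) m! (n-m)! gives the two binomials
--                                                           (binomial-coefficients).

open import Defs
open import Level using (Level)
open import Algebra.Bundles using (CommutativeRing)
open import Algebra.Solver.Ring.AlmostCommutativeRing using (fromCommutativeRing; _-Raw-AlmostCommutative⟶_)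
import Algebra.Solver.Ring
import Algebra.Properties.CommutativeSemigroup as CommSemigroupProps
open import Data.Maybe using (Maybe; nothing; just)
open import Data.Nat as ℕ using (ℕ; zero; suc; _∸_; _≤_; _<_; s≤s; NonZero)
open import Data.Nat.Base using (_!)
import Data.Nat.Properties as ℕP
open import Data.Nat.Tactic.RingSolver using (solve-∀)
open import Data.Integer as ℤ using (ℤ; +_; -[1+_])
import Data.Integer.Properties as ℤP
open import Data.Sign as Sign using (Sign)
open import Data.Empty using (⊥-elim)
open import Relation.Nullary using (¬_; yes; no)
open import Relation.Binary.PropositionalEquality as ≡ using (_≡_; _≢_)

-- Binomial numbers by Pascal's rule.  (The library's _C_ is defined by
-- division, which makes the multiplicative identities below awkward.)
choose : ℕ → ℕ → ℕ
choose n       zero    = 1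
choose zero    (suc k) = 0
choose (suc n) (suc k) = choose n k ℕ.+ choose n (suc k)

choose-vanish : ∀ {n m} → n < m → choose n m ≡ 0
choose-vanish {zero}  {suc m} _         = ≡.refl
choose-vanish {suc n} {suc m} (s≤s n<m) =
  ≡.cong₂ ℕ._+_ (choose-vanish n<m) (choose-vanish (ℕP.m≤n⇒m≤1+n n<m))

∸-atLeastTwo : ∀ {i m} → i < m → suc m ∸ i ≡ suc (suc (m ∸ suc i))
∸-atLeastTwo {zero}  {suc m} _         = ≡.refl
∸-atLeastTwo {suc i} {suc m} (s≤s i<m) = ∸-atLeastTwo i<m

choose-absorb : ∀ n m → suc n ℕ.* choose n m ≡ suc m ℕ.* choose (suc n) (suc m)
choose-absorb zero    zero    = ≡.refl
choose-absorb zero    (suc m) = ≡.sym (ℕP.*-zeroʳ (suc (suc m)))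
choose-absorb (suc n) zero    =
  ≡.trans (unfold n (choose (suc n) 1)) (≡.cong suc (choose-absorb n zero))
  where
  unfold : ∀ n x → suc (suc n) ℕ.* 1 ≡ suc (suc n ℕ.* 1)
  unfold = solve-∀
choose-absorb (suc n) (suc m) = begin
  suc (suc n) ℕ.* (a ℕ.+ b)                         ≡⟨ expand n a b ⟩
  (suc n ℕ.* a ℕ.+ suc n ℕ.* b) ℕ.+ (a ℕ.+ b)       ≡⟨ ≡.cong₂ (λ x y → (x ℕ.+ y) ℕ.+ (a ℕ.+ b))
                                                          (choose-absorb n m) (choose-absorb n (suc m)) ⟩
  (suc m ℕ.* (a ℕ.+ b) ℕ.+ suc (suc m) ℕ.* d) ℕ.+ (a ℕ.+ b) ≡⟨ collect m a b d ⟩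
  suc (suc m) ℕ.* ((a ℕ.+ b) ℕ.+ d)                 ∎
  where
  open ≡.≡-Reasoning
  a = choose n m
  b = choose n (suc m)
  d = choose (suc n) (suc (suc m))
  expand : ∀ n a b → suc (suc n) ℕ.* (a ℕ.+ b) ≡ (suc n ℕ.* a ℕ.+ suc n ℕ.* b) ℕ.+ (a ℕ.+ b)
  expand = solve-∀
  collect : ∀ m a b d → (suc m ℕ.* (a ℕ.+ b) ℕ.+ suc (suc m) ℕ.* d) ℕ.+ (a ℕ.+ b)
                        ≡ suc (suc m) ℕ.* ((a ℕ.+ b) ℕ.+ d)
  collect = solve-∀

choose-factorials : ∀ n m → m ≤ n → choose n m ℕ.* (m ! ℕ.* (n ∸ m) !) ≡ n !
choose-factorials n       zero    _         = ≡.trans (ℕP.*-identityˡ _) (ℕP.*-identityˡ _)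
choose-factorials (suc n) (suc m) (s≤s m≤n) = begin
  d ℕ.* ((suc m ℕ.* m !) ℕ.* r)       ≡⟨ regroup d (suc m) (m !) r ⟩
  (suc m ℕ.* d) ℕ.* (m ! ℕ.* r)       ≡⟨ ≡.cong (ℕ._* (m ! ℕ.* r)) (≡.sym (choose-absorb n m)) ⟩
  (suc n ℕ.* choose n m) ℕ.* (m ! ℕ.* r) ≡⟨ ℕP.*-assoc (suc n) (choose n m) _ ⟩
  suc n ℕ.* (choose n m ℕ.* (m ! ℕ.* r)) ≡⟨ ≡.cong (suc n ℕ.*_) (choose-factorials n m m≤n) ⟩
  suc n ℕ.* n !                       ∎
  where
  open ≡.≡-Reasoning
  d = choose (suc n) (suc m)
  r = (n ∸ m) !
  regroup : ∀ d s f r → d ℕ.* ((s ℕ.* f) ℕ.* r) ≡ (s ℕ.* d) ℕ.* (f ℕ.* r)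
  regroup = solve-∀

-- The ring solver for an arbitrary commutative ring, with integer
-- coefficients interpreted through the canonical map ℤ → R.  Integer
-- coefficients (with decidable equality) let the solver cancel terms.
module IntegerCoefficients {c ℓ} (R : CommutativeRing c ℓ) where
  open CommutativeRing R
  open import Algebra.Properties.Ring ring using (-‿distribˡ-*; -‿involutive; -0#≈0#; -‿+-comm)
  open import Relation.Binary.Reasoning.Setoid setoid
  open CommSemigroupProps +-commutativeSemigroup using () renaming (interchange to +-interchange)
  open CommSemigroupProps *-commutativeSemigroup using () renaming (interchange to *-interchange)

  private
    nat : ℕ → Carrier
    nat = natR R

  nat-+ : ∀ m n → nat (m ℕ.+ n) ≈ nat m + nat n
  nat-+ zero    n = sym (+-identityˡ _)
  nat-+ (suc m) n = trans (+-congˡ (nat-+ m n)) (sym (+-assoc _ _ _))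

  nat-* : ∀ m n → nat (m ℕ.* n) ≈ nat m * nat n
  nat-* zero    n = sym (zeroˡ _)
  nat-* (suc m) n = begin
    nat (n ℕ.+ m ℕ.* n)          ≈⟨ nat-+ n (m ℕ.* n) ⟩
    nat n + nat (m ℕ.* n)        ≈⟨ +-cong (sym (*-identityˡ _)) (nat-* m n) ⟩
    1# * nat n + nat m * nat n   ≈⟨ sym (distribʳ _ _ _) ⟩
    (1# + nat m) * nat n         ∎

  private
    int : ℤ → Carrier
    int (+ n)     = nat n
    int -[1+ n ]  = - nat (suc n)

    int-⊖ : ∀ m n → int (m ℤ.⊖ n) ≈ nat m + - nat n
    int-⊖ m       zero    = sym (trans (+-congˡ -0#≈0#) (+-identityʳ _))
    int-⊖ zero    (suc n) = sym (+-identityˡ _)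
    int-⊖ (suc m) (suc n) = begin
      int (suc m ℤ.⊖ suc n)            ≈⟨ reflexive (≡.cong int (ℤP.[1+m]⊖[1+n]≡m⊖n m n)) ⟩
      int (m ℤ.⊖ n)                    ≈⟨ int-⊖ m n ⟩
      nat m + - nat n                  ≈⟨ sym (+-identityˡ _) ⟩
      0# + (nat m + - nat n)           ≈⟨ +-congʳ (sym (-‿inverseʳ 1#)) ⟩
      (1# + - 1#) + (nat m + - nat n)  ≈⟨ +-interchange _ _ _ _ ⟩
      (1# + nat m) + (- 1# + - nat n)  ≈⟨ +-congˡ (-‿+-comm _ _) ⟩
      (1# + nat m) + - (1# + nat n)    ∎

    int-+ : ∀ i j → int (i ℤ.+ j) ≈ int i + int j
    int-+ -[1+ m ] -[1+ n ] = begin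
      - nat (suc (suc (m ℕ.+ n)))    ≈⟨ -‿cong (reflexive (≡.cong (λ k → nat (suc k)) (≡.sym (ℕP.+-suc m n)))) ⟩
      - nat (suc m ℕ.+ suc n)        ≈⟨ -‿cong (nat-+ (suc m) (suc n)) ⟩
      - (nat (suc m) + nat (suc n))  ≈⟨ sym (-‿+-comm _ _) ⟩
      - nat (suc m) + - nat (suc n)  ∎
    int-+ -[1+ m ] (+ n)    = trans (int-⊖ n (suc m)) (+-comm _ _)
    int-+ (+ m)    -[1+ n ] = int-⊖ m (suc n)
    int-+ (+ m)    (+ n)    = nat-+ m n

    sign : Sign → Carrier
    sign Sign.+ = 1#
    sign Sign.- = - 1#

    minus-one-* : ∀ x → - 1# * x ≈ - x
    minus-one-* x = trans (sym (-‿distribˡ-* _ _)) (-‿cong (*-identityˡ _))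

    int-◃ : ∀ s n → int (s ℤ.◃ n) ≈ sign s * nat n
    int-◃ s       zero    = sym (zeroʳ _)
    int-◃ Sign.+  (suc n) = sym (*-identityˡ _)
    int-◃ Sign.-  (suc n) = sym (minus-one-* _)

    int-signAbs : ∀ i → int i ≈ sign (ℤ.sign i) * nat ℤ.∣ i ∣
    int-signAbs (+ n)    = sym (*-identityˡ _)
    int-signAbs -[1+ n ] = sym (minus-one-* _)

    sign-* : ∀ s t → sign (s Sign.* t) ≈ sign s * sign t
    sign-* Sign.- Sign.- = sym (trans (minus-one-* _) (-‿involutive _))
    sign-* Sign.- Sign.+ = sym (*-identityʳ _)
    sign-* Sign.+ Sign.- = sym (*-identityˡ _)
    sign-* Sign.+ Sign.+ = sym (*-identityˡ _)

    int-* : ∀ i j → int (i ℤ.* j) ≈ int i * int j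
    int-* i j = begin
      int (ℤ.sign i Sign.* ℤ.sign j ℤ.◃ ℤ.∣ i ∣ ℕ.* ℤ.∣ j ∣)          ≈⟨ int-◃ (ℤ.sign i Sign.* ℤ.sign j) (ℤ.∣ i ∣ ℕ.* ℤ.∣ j ∣) ⟩
      sign (ℤ.sign i Sign.* ℤ.sign j) * nat (ℤ.∣ i ∣ ℕ.* ℤ.∣ j ∣)     ≈⟨ *-cong (sign-* (ℤ.sign i) (ℤ.sign j)) (nat-* ℤ.∣ i ∣ ℤ.∣ j ∣) ⟩
      (sign (ℤ.sign i) * sign (ℤ.sign j)) * (nat ℤ.∣ i ∣ * nat ℤ.∣ j ∣) ≈⟨ *-interchange _ _ _ _ ⟩
      (sign (ℤ.sign i) * nat ℤ.∣ i ∣) * (sign (ℤ.sign j) * nat ℤ.∣ j ∣) ≈⟨ sym (*-cong (int-signAbs i) (int-signAbs j)) ⟩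
      int i * int j                                                   ∎

    int-neg : ∀ i → int (ℤ.- i) ≈ - int i
    int-neg -[1+ n ]  = sym (-‿involutive _)
    int-neg (+ zero)  = sym -0#≈0#
    int-neg (+ suc n) = refl

    -- The same map, except that 1 is sent to 1# on the nose, so that the
    -- solver's constant 1 is literally the ring's 1#.
    coeff : ℤ → Carrier
    coeff (+ 1) = 1#
    coeff i     = int i

    coeff≈int : ∀ i → coeff i ≈ int i
    coeff≈int (+ zero)        = refl
    coeff≈int (+ suc zero)    = sym (+-identityʳ 1#)
    coeff≈int (+ suc (suc n)) = refl
    coeff≈int -[1+ n ]        = refl

    coeff-morphism : ℤ.+-*-rawRing -Raw-AlmostCommutative⟶ fromCommutativeRing R
    coeff-morphism = record
      { ⟦_⟧    = coeff
      ; +-homo = λ i j → trans (coeff≈int (i ℤ.+ j)) (trans (int-+ i j) (sym (+-cong (coeff≈int i) (coeff≈int j))))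
      ; *-homo = λ i j → trans (coeff≈int (i ℤ.* j)) (trans (int-* i j) (sym (*-cong (coeff≈int i) (coeff≈int j))))
      ; -‿homo = λ i → trans (coeff≈int (ℤ.- i)) (trans (int-neg i) (-‿cong (sym (coeff≈int i))))
      ; 0-homo = refl
      ; 1-homo = refl
      }

    coeff-≟ : ∀ i j → Maybe (coeff i ≈ coeff j)
    coeff-≟ i j with i ℤ.≟ j
    ... | yes i≡j = just (reflexive (≡.cong coeff i≡j))
    ... | no  _   = nothing

  open Algebra.Solver.Ring ℤ.+-*-rawRing (fromCommutativeRing R) coeff-morphism coeff-≟ public
    using (solve; _:=_; _:+_; _:*_; :-_; con)

module Development {c ℓ : Level} (F : CharZeroField c ℓ) where
  open CharZeroField F hiding (zero)
  open Poly F hiding (Carrier; _+_; _*_; -_)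
  open IntegerCoefficients commutativeRing using (nat-+; nat-*; solve; _:=_; _:+_; _:*_; :-_; con)
  open import Relation.Binary.Reasoning.Setoid setoid

  natAt : ∀ {m n} → m ≡ n → nat m ≈ nat n
  natAt ≡.refl = refl

  Σ-cong : ∀ n {f g : ℕ → Carrier} → (∀ i → i < n → f i ≈ g i) → Σ< n f ≈ Σ< n g
  Σ-cong zero    f≈g = refl
  Σ-cong (suc n) f≈g = +-cong (Σ-cong n (λ i i<n → f≈g i (ℕP.m<n⇒m<1+n i<n))) (f≈g n ℕP.≤-refl)

  Σ-cong′ : ∀ n {f g : ℕ → Carrier} → (∀ i → f i ≈ g i) → Σ< n f ≈ Σ< n g
  Σ-cong′ n f≈g = Σ-cong n (λ i _ → f≈g i)

  Σ-zero : ∀ n {f : ℕ → Carrier} → (∀ i → i < n → f i ≈ 0#) → Σ< n f ≈ 0#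
  Σ-zero n f≈0 = trans (Σ-cong n f≈0) (zero-sum n)
    where
    zero-sum : ∀ n → Σ< n (λ _ → 0#) ≈ 0#
    zero-sum zero    = refl
    zero-sum (suc n) = trans (+-identityʳ _) (zero-sum n)

  Σ-+ : ∀ n (f g : ℕ → Carrier) → Σ< n (λ i → f i + g i) ≈ Σ< n f + Σ< n g
  Σ-+ zero    f g = sym (+-identityʳ 0#)
  Σ-+ (suc n) f g = trans (+-congʳ (Σ-+ n f g)) (+-interchange _ _ _ _)
    where open CommSemigroupProps +-commutativeSemigroup using () renaming (interchange to +-interchange)

  Σ-*ˡ : ∀ n a (f : ℕ → Carrier) → a * Σ< n f ≈ Σ< n (λ i → a * f i)
  Σ-*ˡ zero    a f = zeroʳ a
  Σ-*ˡ (suc n) a f = trans (distribˡ a _ _) (+-congʳ (Σ-*ˡ n a f))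

  Σ-*ʳ : ∀ n a (f : ℕ → Carrier) → Σ< n f * a ≈ Σ< n (λ i → f i * a)
  Σ-*ʳ n a f = trans (*-comm _ _) (trans (Σ-*ˡ n a f) (Σ-cong′ n (λ i → *-comm _ _)))

  Σ-head : ∀ n (f : ℕ → Carrier) → Σ< (suc n) f ≈ f 0 + Σ< n (λ i → f (suc i))
  Σ-head zero    f = trans (+-identityˡ _) (sym (+-identityʳ _))
  Σ-head (suc n) f = trans (+-congʳ (Σ-head n f)) (+-assoc _ _ _)

  Σ-swap : ∀ n m (h : ℕ → ℕ → Carrier) →
           Σ< n (λ i → Σ< m (λ j → h i j)) ≈ Σ< m (λ j → Σ< n (λ i → h i j))
  Σ-swap zero    m h = sym (Σ-zero m (λ _ _ → refl))
  Σ-swap (suc n) m h = trans (+-congʳ (Σ-swap n m h)) (sym (Σ-+ m (λ j → Σ< n (λ i → h i j)) (h n)))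

  Σ-single : ∀ n k (f : ℕ → Carrier) → k < n → (∀ i → i < n → i ≢ k → f i ≈ 0#) → Σ< n f ≈ f k
  Σ-single (suc n) k f k<n others with k ℕ.≟ n
  ... | yes ≡.refl = trans (+-congʳ (Σ-zero n (λ i i<n → others i (ℕP.m<n⇒m<1+n i<n) (ℕP.<⇒≢ i<n))))
                           (+-identityˡ _)
  ... | no  k≢n    = trans (+-cong (Σ-single n k f (ℕP.≤∧≢⇒< (ℕP.≤-pred k<n) k≢n)
                                               (λ i i<n → others i (ℕP.m<n⇒m<1+n i<n)))
                                   (others n ℕP.≤-refl (λ n≡k → k≢n (≡.sym n≡k))))
                           (+-identityʳ _)

  ≋-refl : ∀ {f} → f ≋ f
  ≋-refl _ = refl

  ≋-sym : ∀ {f g} → f ≋ g → g ≋ f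
  ≋-sym f≋g m = sym (f≋g m)

  ≋-trans : ∀ {f g h} → f ≋ g → g ≋ h → f ≋ h
  ≋-trans f≋g g≋h m = trans (f≋g m) (g≋h m)

  ⊛-cong : ∀ {f f′ g g′} → f ≋ f′ → g ≋ g′ → (f ⊛ g) ≋ (f′ ⊛ g′)
  ⊛-cong f≋f′ g≋g′ m = Σ-cong′ (suc m) (λ i → *-cong (f≋f′ i) (g≋g′ (m ∸ i)))

  ⊛-congˡ : ∀ {f g g′} → g ≋ g′ → (f ⊛ g) ≋ (f ⊛ g′)
  ⊛-congˡ {f = f} = ⊛-cong {f = f} ≋-refl

  ⊛-congʳ : ∀ {f f′ g} → f ≋ f′ → (f ⊛ g) ≋ (f′ ⊛ g)
  ⊛-congʳ {g = g} f≋f′ = ⊛-cong {g = g} f≋f′ ≋-refl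

  dropHead : Ser → Ser
  dropHead f i = f (suc i)

  ⊛-head : ∀ f g → (f ⊛ g) 0 ≈ f 0 * g 0
  ⊛-head f g = +-identityˡ _

  ⊛-step : ∀ f g m → (f ⊛ g) (suc m) ≈ f 0 * g (suc m) + (dropHead f ⊛ g) m
  ⊛-step f g m = Σ-head (suc m) (λ i → f i * g (suc m ∸ i))

  ⊛-distribˡ : ∀ h f g → (h ⊛ (f ⊕ g)) ≋ ((h ⊛ f) ⊕ (h ⊛ g))
  ⊛-distribˡ h f g m = trans (Σ-cong′ (suc m) (λ i → distribˡ _ _ _)) (Σ-+ (suc m) _ _)

  ⊛-distribʳ : ∀ h f g → ((f ⊕ g) ⊛ h) ≋ ((f ⊛ h) ⊕ (g ⊛ h))
  ⊛-distribʳ h f g m = trans (Σ-cong′ (suc m) (λ i → distribʳ _ _ _)) (Σ-+ (suc m) _ _)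

  ⊛-scaleˡ : ∀ h a f → (scale a f ⊛ h) ≋ scale a (f ⊛ h)
  ⊛-scaleˡ h a f m = trans (Σ-cong′ (suc m) (λ i → *-assoc _ _ _)) (sym (Σ-*ˡ (suc m) a _))

  ⊛-scaleʳ : ∀ h a f → (h ⊛ scale a f) ≋ scale a (h ⊛ f)
  ⊛-scaleʳ h a f m = trans (Σ-cong′ (suc m) (λ i → solve 3 (λ x y z → x :* (y :* z) := y :* (x :* z)) refl _ _ _))
                           (sym (Σ-*ˡ (suc m) a _))

  ⊛-ΣS : ∀ h n G → (h ⊛ ΣS< n G) ≋ ΣS< n (λ i → h ⊛ G i)
  ⊛-ΣS h zero    G m = Σ-zero (suc m) {λ i → h i * 0#} (λ i _ → zeroʳ _)
  ⊛-ΣS h (suc n) G m = trans (⊛-distribˡ h (ΣS< n G) (G n) m) (+-congʳ (⊛-ΣS h n G m))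

  ⊛-identityˡ : ∀ g → (const 1# ⊛ g) ≋ g
  ⊛-identityˡ g zero    = trans (⊛-head (const 1#) g) (*-identityˡ _)
  ⊛-identityˡ g (suc m) = trans (⊛-step (const 1#) g m)
    (trans (+-cong (*-identityˡ _) (Σ-zero (suc m) {λ i → 0# * g (m ∸ i)} (λ i _ → zeroˡ _))) (+-identityʳ _))

  ⊛-assoc : ∀ f g h → ((f ⊛ g) ⊛ h) ≋ (f ⊛ (g ⊛ h))
  ⊛-assoc f g h zero = begin
    ((f ⊛ g) ⊛ h) 0    ≈⟨ trans (⊛-head (f ⊛ g) h) (*-congʳ (⊛-head f g)) ⟩
    (f 0 * g 0) * h 0  ≈⟨ *-assoc _ _ _ ⟩
    f 0 * (g 0 * h 0)  ≈⟨ sym (trans (⊛-head f (g ⊛ h)) (*-congˡ (⊛-head g h))) ⟩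
    (f ⊛ (g ⊛ h)) 0    ∎
  ⊛-assoc f g h (suc m) = begin
    ((f ⊛ g) ⊛ h) (suc m)
      ≈⟨ trans (⊛-step (f ⊛ g) h m) (+-cong (*-congʳ (⊛-head f g)) (⊛-congʳ {g = h} (⊛-step f g) m)) ⟩
    (f 0 * g 0) * h (suc m) + ((scale (f 0) (dropHead g) ⊕ (dropHead f ⊛ g)) ⊛ h) m
      ≈⟨ +-congˡ (trans (⊛-distribʳ h _ _ m) (+-cong (⊛-scaleˡ h (f 0) (dropHead g) m) (⊛-assoc (dropHead f) g h m))) ⟩
    (f 0 * g 0) * h (suc m) + (f 0 * (dropHead g ⊛ h) m + (dropHead f ⊛ (g ⊛ h)) m)
      ≈⟨ solve 5 (λ a b c d e → (a :* b) :* c :+ (a :* d :+ e) := a :* (b :* c :+ d) :+ e) refl _ _ _ _ _ ⟩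
    f 0 * (g 0 * h (suc m) + (dropHead g ⊛ h) m) + (dropHead f ⊛ (g ⊛ h)) m
      ≈⟨ sym (trans (⊛-step f (g ⊛ h) m) (+-congʳ (*-congˡ (⊛-step g h m)))) ⟩
    (f ⊛ (g ⊛ h)) (suc m) ∎

  ⊛-degreeOneʳ : ∀ f L → (∀ k → L (suc (suc k)) ≈ 0#) → ∀ m →
                 (f ⊛ L) (suc m) ≈ f m * L 1 + f (suc m) * L 0
  ⊛-degreeOneʳ f L high m = begin
    (Σ< m h + h m) + h (suc m)    ≈⟨ +-congʳ (+-congʳ (Σ-zero m far)) ⟩
    (0# + h m) + h (suc m)        ≈⟨ +-cong (trans (+-identityˡ _) (*-congˡ (atIndex (ℕP.m+n∸n≡m 1 m))))
                                           (*-congˡ (atIndex (ℕP.n∸n≡0 m))) ⟩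
    f m * L 1 + f (suc m) * L 0   ∎
    where
    h : ℕ → Carrier
    h i = f i * L (suc m ∸ i)
    atIndex : ∀ {j k} → j ≡ k → L j ≈ L k
    atIndex j≡k = reflexive (≡.cong L j≡k)
    far : ∀ i → i < m → h i ≈ 0#
    far i i<m = trans (*-congˡ (trans (atIndex (∸-atLeastTwo i<m)) (high _))) (zeroʳ _)

  ⊛-identityʳ : ∀ f → (f ⊛ const 1#) ≋ f
  ⊛-identityʳ f zero    = trans (⊛-head f (const 1#)) (*-identityʳ _)
  ⊛-identityʳ f (suc m) = trans (⊛-degreeOneʳ f (const 1#) (λ _ → refl) m)
    (trans (+-cong (zeroʳ _) (*-identityʳ _)) (+-identityˡ _))

  powS-+ : ∀ f a b → (powS f a ⊛ powS f b) ≋ powS f (a ℕ.+ b)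
  powS-+ f zero    b = ⊛-identityˡ (powS f b)
  powS-+ f (suc a) b = ≋-trans (⊛-assoc f (powS f a) (powS f b)) (⊛-congˡ {f = f} (powS-+ f a b))

  powS-index : ∀ f {a b} → a ≡ b → powS f a ≋ powS f b
  powS-index f ≡.refl = ≋-refl

  powS-snoc : ∀ f k → powS f (suc k) ≋ (powS f k ⊛ f)
  powS-snoc f k = ≋-trans (powS-index f (ℕP.+-comm 1 k))
                  (≋-trans (≋-sym (powS-+ f k 1)) (⊛-congˡ {f = powS f k} (⊛-identityʳ f)))

  -- Evaluation at t of the polynomial formed by the coefficients below degree N,
  -- and the property that a series vanishes from degree N on.

  ev : ℕ → Ser → Carrier → Carrier
  ev N f t = Σ< N (λ i → f i * pow t i)

  Deg< : ℕ → Ser → Set ℓ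
  Deg< N f = ∀ i → N ≤ i → f i ≈ 0#

  ev-cong : ∀ N {f g} t → f ≋ g → ev N f t ≈ ev N g t
  ev-cong N t f≋g = Σ-cong′ N (λ i → *-congʳ (f≋g i))

  Deg<-cong : ∀ N {f g} → f ≋ g → Deg< N f → Deg< N g
  Deg<-cong N f≋g deg i N≤i = trans (sym (f≋g i)) (deg i N≤i)

  ev-extend : ∀ N f t → Deg< N f → ∀ k → ev (N ℕ.+ k) f t ≈ ev N f t
  ev-extend N f t deg zero    rewrite ℕP.+-identityʳ N = refl
  ev-extend N f t deg (suc k) rewrite ℕP.+-suc N k =
    trans (+-cong (ev-extend N f t deg k) (trans (*-congʳ (deg (N ℕ.+ k) (ℕP.m≤m+n N k))) (zeroˡ _)))
          (+-identityʳ _)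

  ev-ΣS : ∀ N K H t → ev N (ΣS< K H) t ≈ Σ< K (λ j → ev N (H j) t)
  ev-ΣS N K H t = trans (Σ-cong′ N (λ i → Σ-*ʳ K _ _)) (Σ-swap N K (λ i j → H j i * pow t i))

  ev-scale : ∀ N a h t → ev N (scale a h) t ≈ a * ev N h t
  ev-scale N a h t = trans (Σ-cong′ N (λ i → *-assoc _ _ _)) (sym (Σ-*ˡ N a _))

  const-Deg<1 : ∀ a → Deg< 1 (const a)
  const-Deg<1 a (suc i) _ = refl

  Lin : Carrier → Ser
  Lin a = X ⊕ const a

  Lin-high : ∀ a k → Lin a (suc (suc k)) ≈ 0#
  Lin-high a k = +-identityʳ 0#

  ⊛-Lin-Deg< : ∀ N f a → Deg< N f → Deg< (suc N) (f ⊛ Lin a)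
  ⊛-Lin-Deg< N f a deg (suc m) (s≤s N≤m) = begin
    (f ⊛ Lin a) (suc m)               ≈⟨ ⊛-degreeOneʳ f (Lin a) (Lin-high a) m ⟩
    f m * Lin a 1 + f (suc m) * Lin a 0 ≈⟨ +-cong (*-congʳ (deg m N≤m)) (*-congʳ (deg (suc m) (ℕP.m≤n⇒m≤1+n N≤m))) ⟩
    0# * Lin a 1 + 0# * Lin a 0       ≈⟨ trans (+-cong (zeroˡ _) (zeroˡ _)) (+-identityʳ 0#) ⟩
    0#                                ∎

  ev-⊛-Lin-boundary : ∀ N f a t → ev (suc N) (f ⊛ Lin a) t ≈ ev N f t * (t + a) + a * (f N * pow t N)
  ev-⊛-Lin-boundary zero    f a t =
    solve 3 (λ t f a → con (+ 0) :+ (con (+ 0) :+ f :* (con (+ 0) :+ a)) :* con (+ 1)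
                       := con (+ 0) :* (t :+ a) :+ a :* (f :* con (+ 1))) refl t (f 0) a
  ev-⊛-Lin-boundary (suc N) f a t = begin
    ev (suc N) (f ⊛ Lin a) t + (f ⊛ Lin a) (suc N) * pow t (suc N)
      ≈⟨ +-cong (ev-⊛-Lin-boundary N f a t) (*-congʳ (⊛-degreeOneʳ f (Lin a) (Lin-high a) N)) ⟩
    (ev N f t * (t + a) + a * (f N * pow t N)) + (f N * (1# + 0#) + f (suc N) * (0# + a)) * (t * pow t N)
      ≈⟨ solve 6 (λ E t a fN tN fS → (E :* (t :+ a) :+ a :* (fN :* tN))
                                      :+ (fN :* (con (+ 1) :+ con (+ 0)) :+ fS :* (con (+ 0) :+ a)) :* (t :* tN)
                := (E :+ fN :* tN) :* (t :+ a) :+ a :* (fS :* (t :* tN)))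
               refl (ev N f t) t a (f N) (pow t N) (f (suc N)) ⟩
    (ev N f t + f N * pow t N) * (t + a) + a * (f (suc N) * (t * pow t N)) ∎

  ev-⊛-Lin : ∀ N f a t → Deg< N f → ev (suc N) (f ⊛ Lin a) t ≈ ev N f t * (t + a)
  ev-⊛-Lin N f a t deg = begin
    ev (suc N) (f ⊛ Lin a) t                       ≈⟨ ev-⊛-Lin-boundary N f a t ⟩
    ev N f t * (t + a) + a * (f N * pow t N)       ≈⟨ +-congˡ (*-congˡ (*-congʳ (deg N ℕP.≤-refl))) ⟩
    ev N f t * (t + a) + a * (0# * pow t N)        ≈⟨ +-congˡ (trans (*-congˡ (zeroˡ _)) (zeroʳ _)) ⟩
    ev N f t * (t + a) + 0#                        ≈⟨ +-identityʳ _ ⟩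
    ev N f t * (t + a)                             ∎

  module LinearProducts (b : ℕ → Carrier) where
    ΠLin : ℕ → Ser
    ΠLin q = ΠS< q (λ i → Lin (b i))

    ⊛-ΠLin-Deg< : ∀ q f N → Deg< N f → Deg< (N ℕ.+ q) (f ⊛ ΠLin q)
    ⊛-ΠLin-Deg< zero    f N deg rewrite ℕP.+-identityʳ N = Deg<-cong N (≋-sym (⊛-identityʳ f)) deg
    ⊛-ΠLin-Deg< (suc q) f N deg rewrite ℕP.+-suc N q =
      Deg<-cong (suc (N ℕ.+ q)) (⊛-assoc f (ΠLin q) (Lin (b q)))
        (⊛-Lin-Deg< (N ℕ.+ q) (f ⊛ ΠLin q) (b q) (⊛-ΠLin-Deg< q f N deg))

    ev-⊛-ΠLin : ∀ q f N t → Deg< N f → ev (N ℕ.+ q) (f ⊛ ΠLin q) t ≈ ev N f t * Π< q (λ i → t + b i)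
    ev-⊛-ΠLin zero    f N t deg rewrite ℕP.+-identityʳ N = trans (ev-cong N t (⊛-identityʳ f)) (sym (*-identityʳ _))
    ev-⊛-ΠLin (suc q) f N t deg rewrite ℕP.+-suc N q = begin
      ev (suc (N ℕ.+ q)) (f ⊛ ΠLin (suc q)) t
        ≈⟨ ev-cong (suc (N ℕ.+ q)) t (≋-sym (⊛-assoc f (ΠLin q) (Lin (b q)))) ⟩
      ev (suc (N ℕ.+ q)) ((f ⊛ ΠLin q) ⊛ Lin (b q)) t
        ≈⟨ ev-⊛-Lin (N ℕ.+ q) (f ⊛ ΠLin q) (b q) t (⊛-ΠLin-Deg< q f N deg) ⟩
      ev (N ℕ.+ q) (f ⊛ ΠLin q) t * (t + b q)           ≈⟨ *-congʳ (ev-⊛-ΠLin q f N t deg) ⟩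
      (ev N f t * Π< q (λ i → t + b i)) * (t + b q)     ≈⟨ *-assoc _ _ _ ⟩
      ev N f t * Π< (suc q) (λ i → t + b i)             ∎

    ΠLin-Deg< : ∀ q → Deg< (suc q) (ΠLin q)
    ΠLin-Deg< q = Deg<-cong (suc q) (⊛-identityˡ (ΠLin q)) (⊛-ΠLin-Deg< q (const 1#) 1 (const-Deg<1 1#))

    ev-ΠLin : ∀ q t → ev (suc q) (ΠLin q) t ≈ Π< q (λ i → t + b i)
    ev-ΠLin q t = begin
      ev (suc q) (ΠLin q) t                          ≈⟨ sym (ev-cong (suc q) t (⊛-identityˡ (ΠLin q))) ⟩
      ev (suc q) (const 1# ⊛ ΠLin q) t               ≈⟨ ev-⊛-ΠLin q (const 1#) 1 t (const-Deg<1 1#) ⟩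
      (0# + 1# * 1#) * Π< q (λ i → t + b i)          ≈⟨ *-congʳ (trans (+-identityˡ _) (*-identityˡ _)) ⟩
      1# * Π< q (λ i → t + b i)                      ≈⟨ *-identityˡ _ ⟩
      Π< q (λ i → t + b i)                           ∎

  powLin-Deg< : ∀ a j → Deg< (suc j) (powS (Lin a) j)
  powLin-Deg< a zero    = const-Deg<1 1#
  powLin-Deg< a (suc j) = Deg<-cong (suc (suc j)) (≋-sym (powS-snoc (Lin a) j))
                            (⊛-Lin-Deg< (suc j) _ a (powLin-Deg< a j))

  ev-powLin : ∀ a j t → ev (suc j) (powS (Lin a) j) t ≈ pow (t + a) j
  ev-powLin a zero    t = trans (+-identityˡ _) (*-identityˡ _)
  ev-powLin a (suc j) t = begin
    ev (suc (suc j)) (powS (Lin a) (suc j)) t      ≈⟨ ev-cong (suc (suc j)) t (powS-snoc (Lin a) j) ⟩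
    ev (suc (suc j)) (powS (Lin a) j ⊛ Lin a) t    ≈⟨ ev-⊛-Lin (suc j) _ a t (powLin-Deg< a j) ⟩
    ev (suc j) (powS (Lin a) j) t * (t + a)        ≈⟨ *-congʳ (ev-powLin a j t) ⟩
    pow (t + a) j * (t + a)                        ≈⟨ *-comm _ _ ⟩
    pow (t + a) (suc j)                            ∎

  ev-E : ∀ a n g t → ev (suc n) (E a n g) t ≈ ev (suc n) g (t + a)
  ev-E a n g t = trans (ev-ΣS (suc n) (suc n) _ t) (Σ-cong (suc n) term)
    where
    term : ∀ j → j < suc n → ev (suc n) (scale (g j) (powS (Lin a) j)) t ≈ g j * pow (t + a) j
    term j (s≤s j≤n) = trans (ev-scale (suc n) (g j) _ t) (*-congˡ (begin
      ev (suc n) (powS (Lin a) j) t                  ≈⟨ reflexive (≡.cong (λ N → ev N (powS (Lin a) j) t)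
                                                                        (≡.sym (≡.cong suc (ℕP.m+[n∸m]≡n j≤n)))) ⟩
      ev (suc j ℕ.+ (n ∸ j)) (powS (Lin a) j) t      ≈⟨ ev-extend (suc j) _ t (powLin-Deg< a j) (n ∸ j) ⟩
      ev (suc j) (powS (Lin a) j) t                  ≈⟨ ev-powLin a j t ⟩
      pow (t + a) j                                  ∎))

  fall : Carrier → ℕ → Carrier
  fall a k = Π< k (λ i → a − nat i)

  fall-cong : ∀ {a b} k → a ≈ b → fall a k ≈ fall b k
  fall-cong zero    a≈b = refl
  fall-cong (suc k) a≈b = *-cong (fall-cong k a≈b) (+-congʳ a≈b)

  fall-split : ∀ a k l → fall a (k ℕ.+ l) ≈ fall a k * fall (a − nat k) l
  fall-split a k zero    rewrite ℕP.+-identityʳ k = sym (*-identityʳ _)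
  fall-split a k (suc l) rewrite ℕP.+-suc k l = begin
    fall a (k ℕ.+ l) * (a − nat (k ℕ.+ l))
      ≈⟨ *-cong (fall-split a k l) (+-congˡ (-‿cong (nat-+ k l))) ⟩
    (fall a k * fall (a − nat k) l) * (a − (nat k + nat l))
      ≈⟨ solve 5 (λ x y a k l → (x :* y) :* (a :+ :- (k :+ l)) := x :* (y :* ((a :+ :- k) :+ :- l))) refl _ _ _ _ _ ⟩
    fall a k * (fall (a − nat k) l * ((a − nat k) − nat l)) ∎

  rising-as-fall : ∀ a q → Π< q (λ i → a + nat (suc i)) ≈ fall (a + nat q) q
  rising-as-fall a zero    = refl
  rising-as-fall a (suc q) = begin
    Π< q (λ i → a + nat (suc i)) * (a + nat (suc q))   ≈⟨ *-congʳ (rising-as-fall a q) ⟩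
    fall (a + nat q) q * (a + (1# + nat q))
      ≈⟨ solve 3 (λ z a n → z :* (a :+ (con (+ 1) :+ n)) := (con (+ 1) :* ((a :+ (con (+ 1) :+ n)) :+ :- con (+ 0))) :* z)
               refl _ _ _ ⟩
    fall (a + nat (suc q)) 1 * fall (a + nat q) q
      ≈⟨ *-congˡ (fall-cong q (solve 2 (λ a n → a :+ n := (a :+ (con (+ 1) :+ n)) :+ :- (con (+ 1) :+ con (+ 0))) refl _ _)) ⟩
    fall (a + nat (suc q)) 1 * fall ((a + nat (suc q)) − nat 1) q  ≈⟨ sym (fall-split _ 1 q) ⟩
    fall (a + nat (suc q)) (suc q)                                  ∎

  fall-pascal : ∀ a n → fall (a + 1#) (suc n) ≈ fall a (suc n) + nat (suc n) * fall a n
  fall-pascal a zero    = solve 1 (λ a → con (+ 1) :* ((a :+ con (+ 1)) :+ :- con (+ 0))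
                                        := con (+ 1) :* (a :+ :- con (+ 0)) :+ (con (+ 1) :+ con (+ 0)) :* con (+ 1)) refl a
  fall-pascal a (suc n) = begin
    fall (a + 1#) (suc n) * ((a + 1#) − (1# + nat n))                  ≈⟨ *-congʳ (fall-pascal a n) ⟩
    (fall a n * (a − nat n) + (1# + nat n) * fall a n) * ((a + 1#) − (1# + nat n))
      ≈⟨ solve 3 (λ Y a n → (Y :* (a :+ :- n) :+ (con (+ 1) :+ n) :* Y) :* ((a :+ con (+ 1)) :+ :- (con (+ 1) :+ n))
                := (Y :* (a :+ :- n)) :* (a :+ :- (con (+ 1) :+ n)) :+ (con (+ 1) :+ (con (+ 1) :+ n)) :* (Y :* (a :+ :- n)))
               refl _ _ _ ⟩
    fall a (suc n) * (a − nat (suc n)) + nat (suc (suc n)) * fall a (suc n) ∎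

  sgn : ℕ → Carrier
  sgn m = pow (- 1#) m

  sgn-square : ∀ m → sgn m * sgn m ≈ 1#
  sgn-square zero    = *-identityʳ _
  sgn-square (suc m) = trans (solve 1 (λ s → (:- con (+ 1) :* s) :* (:- con (+ 1) :* s) := s :* s) refl _) (sgn-square m)

  fall-reflect : ∀ a m → fall a m ≈ sgn m * fall (nat m − (a + 1#)) m
  fall-reflect a zero    = sym (*-identityʳ _)
  fall-reflect a (suc m) = begin
    fall a m * (a − nat m)                 ≈⟨ *-congʳ (fall-reflect a m) ⟩
    (sgn m * Z) * (a − nat m)
      ≈⟨ solve 4 (λ s Z a n → (s :* Z) :* (a :+ :- n)
            := (:- con (+ 1) :* s) :* ((con (+ 1) :* (((con (+ 1) :+ n) :+ :- (a :+ con (+ 1))) :+ :- con (+ 0))) :* Z))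
               refl _ _ _ _ ⟩
    sgn (suc m) * (fall y 1 * Z)
      ≈⟨ *-congˡ (*-congˡ (fall-cong m (solve 2 (λ n a → n :+ :- (a :+ con (+ 1))
            := ((con (+ 1) :+ n) :+ :- (a :+ con (+ 1))) :+ :- (con (+ 1) :+ con (+ 0))) refl _ _))) ⟩
    sgn (suc m) * (fall y 1 * fall (y − nat 1) m)  ≈⟨ *-congˡ (sym (fall-split y 1 m)) ⟩
    sgn (suc m) * fall y (suc m)                   ∎
    where
    Z = fall (nat m − (a + 1#)) m
    y = nat (suc m) − (a + 1#)

  -- Powers of 1 - x: multiplying by 1 - x takes differences of coefficients,
  -- so (1-x)^k has coefficients (-1)^m C(k,m).

  om^ : ℕ → Ser
  om^ k = powS oneMinusX k

  oneMinusX-head : ∀ g → (oneMinusX ⊛ g) 0 ≈ g 0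
  oneMinusX-head g = trans (⊛-head oneMinusX g) (solve 1 (λ x → (con (+ 1) :+ :- con (+ 0)) :* x := x) refl _)

  oneMinusX-step : ∀ g m → (oneMinusX ⊛ g) (suc m) ≈ g (suc m) − g m
  oneMinusX-step g m = begin
    (oneMinusX ⊛ g) (suc m)                                ≈⟨ ⊛-step oneMinusX g m ⟩
    oneMinusX 0 * g (suc m) + (dropHead oneMinusX ⊛ g) m   ≈⟨ +-congˡ (⊛-congʳ {g = g} tail m) ⟩
    oneMinusX 0 * g (suc m) + (scale (- 1#) (const 1#) ⊛ g) m
      ≈⟨ +-congˡ (trans (⊛-scaleˡ g (- 1#) (const 1#) m) (*-congˡ (⊛-identityˡ g m))) ⟩
    (1# + - 0#) * g (suc m) + - 1# * g m
      ≈⟨ solve 2 (λ x y → (con (+ 1) :+ :- con (+ 0)) :* x :+ :- con (+ 1) :* y := x :+ :- y) refl _ _ ⟩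
    g (suc m) − g m                                        ∎
    where
    tail : dropHead oneMinusX ≋ scale (- 1#) (const 1#)
    tail zero    = solve 0 (con (+ 0) :+ :- con (+ 1) := :- con (+ 1) :* con (+ 1)) refl
    tail (suc k) = solve 0 (con (+ 0) :+ :- con (+ 0) := :- con (+ 1) :* con (+ 0)) refl

  om^-coeff : ∀ k m → om^ k m ≈ sgn m * nat (choose k m)
  om^-coeff zero    zero    = solve 0 (con (+ 1) := con (+ 1) :* (con (+ 1) :+ con (+ 0))) refl
  om^-coeff zero    (suc m) = sym (zeroʳ _)
  om^-coeff (suc k) zero    = trans (oneMinusX-head (om^ k)) (om^-coeff k zero)
  om^-coeff (suc k) (suc m) = begin
    (oneMinusX ⊛ om^ k) (suc m)                                  ≈⟨ oneMinusX-step (om^ k) m ⟩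
    om^ k (suc m) − om^ k m                                      ≈⟨ +-cong (om^-coeff k (suc m)) (-‿cong (om^-coeff k m)) ⟩
    sgn (suc m) * nat (choose k (suc m)) + - (sgn m * nat (choose k m))
      ≈⟨ solve 3 (λ s x y → (:- con (+ 1) :* s) :* y :+ :- (s :* x) := (:- con (+ 1) :* s) :* (x :+ y)) refl _ _ _ ⟩
    sgn (suc m) * (nat (choose k m) + nat (choose k (suc m)))   ≈⟨ *-congˡ (sym (nat-+ (choose k m) (choose k (suc m)))) ⟩
    sgn (suc m) * nat (choose (suc k) (suc m))                   ∎

  timesX : Ser → Ser
  timesX g zero    = 0#
  timesX g (suc j) = g j

  ⊛-timesX : ∀ h g → (h ⊛ timesX g) ≋ timesX (h ⊛ g)
  ⊛-timesX h g zero    = trans (⊛-head h (timesX g)) (zeroʳ _)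
  ⊛-timesX h g (suc m) = begin
    Σ< (suc m) (λ i → h i * timesX g (suc m ∸ i)) + h (suc m) * timesX g (suc m ∸ suc m)
      ≈⟨ +-cong (Σ-cong (suc m) shifted) (trans (*-congˡ (reflexive (≡.cong (timesX g) (ℕP.n∸n≡0 m)))) (zeroʳ _)) ⟩
    Σ< (suc m) (λ i → h i * g (m ∸ i)) + 0#      ≈⟨ +-identityʳ _ ⟩
    (h ⊛ g) m                                    ∎
    where
    shifted : ∀ i → i < suc m → h i * timesX g (suc m ∸ i) ≈ h i * g (m ∸ i)
    shifted i (s≤s i≤m) = *-congˡ (reflexive (≡.cong (timesX g) (ℕP.+-∸-assoc 1 i≤m)))

  -- Induction on n: (1-x) turns (j+B)_{n+1} into its difference, which by
  -- Pascal's rule is (B)_{n+1} at j = 0 and (n+1)(j-1+B)_n at j > 0.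

  fallValues : ℕ → Carrier → Ser
  fallValues n B j = fall (nat j + B) n

  keySeries : ℕ → Carrier → Ser
  keySeries n B = om^ (suc n) ⊛ fallValues n B

  keyCoeff : ℕ → Carrier → ℕ → Carrier
  keyCoeff n B m = nat (choose n m) * (fall (nat n − B) m * fall B (n ∸ m))

  oneMinusX-fallValues : ∀ n B →
    (oneMinusX ⊛ fallValues (suc n) B) ≋ (scale (fall B (suc n)) (const 1#) ⊕ scale (nat (suc n)) (timesX (fallValues n B)))
  oneMinusX-fallValues n B zero = begin
    (oneMinusX ⊛ fallValues (suc n) B) 0                ≈⟨ oneMinusX-head (fallValues (suc n) B) ⟩
    fall (0# + B) (suc n)                               ≈⟨ fall-cong (suc n) (+-identityˡ B) ⟩
    fall B (suc n)                                      ≈⟨ solve 2 (λ x y → x := x :* con (+ 1) :+ y :* con (+ 0)) refl _ _ ⟩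
    fall B (suc n) * 1# + nat (suc n) * 0#              ∎
  oneMinusX-fallValues n B (suc j) = begin
    (oneMinusX ⊛ fallValues (suc n) B) (suc j)           ≈⟨ oneMinusX-step (fallValues (suc n) B) j ⟩
    fall (nat (suc j) + B) (suc n) + - fall (nat j + B) (suc n)
      ≈⟨ +-congʳ (trans (fall-cong (suc n) (solve 2 (λ x y → (con (+ 1) :+ x) :+ y := (x :+ y) :+ con (+ 1)) refl _ _))
                         (fall-pascal (nat j + B) n)) ⟩
    (fall (nat j + B) (suc n) + nat (suc n) * fall (nat j + B) n) + - fall (nat j + B) (suc n)
      ≈⟨ solve 3 (λ x y b → (x :+ y) :+ :- x := b :* con (+ 0) :+ y) refl _ _ (fall B (suc n)) ⟩
    fall B (suc n) * 0# + nat (suc n) * fall (nat j + B) n ∎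

  keySeries-rec : ∀ n B → keySeries (suc n) B ≋
    (scale (fall B (suc n)) (om^ (suc n)) ⊕ scale (nat (suc n)) (timesX (keySeries n B)))
  keySeries-rec n B m = begin
    (om^ (suc (suc n)) ⊛ fallValues (suc n) B) m
      ≈⟨ ⊛-congʳ {g = fallValues (suc n) B} (powS-snoc oneMinusX (suc n)) m ⟩
    ((om^ (suc n) ⊛ oneMinusX) ⊛ fallValues (suc n) B) m
      ≈⟨ ⊛-assoc (om^ (suc n)) oneMinusX (fallValues (suc n) B) m ⟩
    (om^ (suc n) ⊛ (oneMinusX ⊛ fallValues (suc n) B)) m
      ≈⟨ ⊛-congˡ {f = om^ (suc n)} (oneMinusX-fallValues n B) m ⟩
    (om^ (suc n) ⊛ (scale (fall B (suc n)) (const 1#) ⊕ scale (nat (suc n)) (timesX (fallValues n B)))) m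
      ≈⟨ ⊛-distribˡ (om^ (suc n)) (scale (fall B (suc n)) (const 1#)) (scale (nat (suc n)) (timesX (fallValues n B))) m ⟩
    (om^ (suc n) ⊛ scale (fall B (suc n)) (const 1#)) m + (om^ (suc n) ⊛ scale (nat (suc n)) (timesX (fallValues n B))) m
      ≈⟨ +-cong (⊛-scaleʳ (om^ (suc n)) (fall B (suc n)) (const 1#) m)
                (⊛-scaleʳ (om^ (suc n)) (nat (suc n)) (timesX (fallValues n B)) m) ⟩
    fall B (suc n) * (om^ (suc n) ⊛ const 1#) m + nat (suc n) * (om^ (suc n) ⊛ timesX (fallValues n B)) m
      ≈⟨ +-cong (*-congˡ (⊛-identityʳ (om^ (suc n)) m)) (*-congˡ (⊛-timesX (om^ (suc n)) (fallValues n B) m)) ⟩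
    fall B (suc n) * om^ (suc n) m + nat (suc n) * timesX (keySeries n B) m ∎

  fall-sign-swap : ∀ n B m → m ≤ n → fall (nat n − B) (suc m) * fall B (n ∸ m) ≈ sgn (suc m) * fall B (suc n)
  fall-sign-swap n B m m≤n = begin
    Z * Y                                      ≈⟨ sym (trans (*-congʳ (sgn-square (suc m))) (*-identityˡ _)) ⟩
    (s * s) * (Z * Y)                          ≈⟨ solve 3 (λ s a y → (s :* s) :* (a :* y) := s :* (y :* (s :* a))) refl _ _ _ ⟩
    s * (Y * (s * Z))                          ≈⟨ *-congˡ (*-congˡ (*-congˡ (fall-cong (suc m) reflected))) ⟩
    s * (Y * (s * fall (nat (suc m) − ((B − nat k) + 1#)) (suc m)))
                                               ≈⟨ *-congˡ (*-congˡ (sym (fall-reflect (B − nat k) (suc m)))) ⟩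
    s * (Y * fall (B − nat k) (suc m))         ≈⟨ *-congˡ (sym (fall-split B k (suc m))) ⟩
    s * fall B (k ℕ.+ suc m)                   ≈⟨ *-congˡ (reflexive (≡.cong (fall B) k+m+1≡n+1)) ⟩
    s * fall B (suc n)                         ∎
    where
    k = n ∸ m
    s = sgn (suc m)
    Z = fall (nat n − B) (suc m)
    Y = fall B k
    k+m+1≡n+1 : k ℕ.+ suc m ≡ suc n
    k+m+1≡n+1 = ≡.trans (ℕP.+-suc k m) (≡.cong suc (ℕP.m∸n+n≡m m≤n))
    reflected : nat n − B ≈ nat (suc m) − ((B − nat k) + 1#)
    reflected = begin
      nat n + - B                              ≈⟨ +-congʳ (trans (natAt (≡.sym (ℕP.m∸n+n≡m m≤n))) (nat-+ k m)) ⟩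
      (nat k + nat m) + - B                    ≈⟨ solve 3 (λ k m b → (k :+ m) :+ :- b
                                                    := (con (+ 1) :+ m) :+ :- ((b :+ :- k) :+ con (+ 1))) refl _ _ _ ⟩
      nat (suc m) + - ((B + - nat k) + 1#)     ∎

  keyCoeff-step : ∀ n B m →
    fall B (suc n) * (sgn (suc m) * nat (choose (suc n) (suc m))) + nat (suc n) * keyCoeff n B m ≈ keyCoeff (suc n) B (suc m)
  keyCoeff-step n B m with m ℕP.≤? n
  ... | yes m≤n = begin
    fB * (s * C) + nat (suc n) * (nat (choose n m) * (Fm * Y))
      ≈⟨ +-congˡ (trans (sym (*-assoc _ _ _)) (*-congʳ absorb)) ⟩
    fB * (s * C) + (nat (suc m) * C) * (Fm * Y)
      ≈⟨ solve 6 (λ fB s C Nm Fm Y → fB :* (s :* C) :+ (Nm :* C) :* (Fm :* Y) := C :* (s :* fB) :+ C :* (Nm :* (Fm :* Y)))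
               refl _ _ _ _ _ _ ⟩
    C * (s * fB) + C * (nat (suc m) * (Fm * Y))   ≈⟨ +-congʳ (*-congˡ (sym (fall-sign-swap n B m m≤n))) ⟩
    C * (Fm+1 * Y) + C * (nat (suc m) * (Fm * Y))
      ≈⟨ solve 5 (λ C a y nm fm → C :* (a :* y) :+ C :* (nm :* (fm :* y)) := C :* ((a :+ nm :* fm) :* y)) refl _ _ _ _ _ ⟩
    C * ((Fm+1 + nat (suc m) * Fm) * Y)           ≈⟨ *-congˡ (*-congʳ (sym pascal)) ⟩
    C * (fall (nat (suc n) − B) (suc m) * Y)      ∎
    where
    fB = fall B (suc n)
    s = sgn (suc m)
    C = nat (choose (suc n) (suc m))
    Fm = fall (nat n − B) m
    Fm+1 = fall (nat n − B) (suc m)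
    Y = fall B (n ∸ m)
    absorb : nat (suc n) * nat (choose n m) ≈ nat (suc m) * C
    absorb = trans (sym (nat-* (suc n) (choose n m))) (trans (natAt (choose-absorb n m)) (nat-* (suc m) (choose (suc n) (suc m))))
    pascal : fall (nat (suc n) − B) (suc m) ≈ Fm+1 + nat (suc m) * Fm
    pascal = trans (fall-cong (suc m) (solve 2 (λ n b → (con (+ 1) :+ n) :+ :- b := (n :+ :- b) :+ con (+ 1)) refl _ _))
                   (fall-pascal (nat n − B) m)
  ... | no m≰n = begin
    fall B (suc n) * (sgn (suc m) * nat (choose (suc n) (suc m))) + nat (suc n) * (nat (choose n m) * (Fm * Y))
      ≈⟨ +-cong (*-congˡ (*-congˡ (natAt (choose-vanish (s≤s n<m))))) (*-congˡ (*-congʳ (natAt (choose-vanish n<m)))) ⟩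
    fall B (suc n) * (sgn (suc m) * 0#) + nat (suc n) * (0# * (Fm * Y))
      ≈⟨ solve 5 (λ a b c d e → a :* (b :* con (+ 0)) :+ c :* (con (+ 0) :* d) := con (+ 0) :* e) refl _ _ _ _ _ ⟩
    0# * (fall (nat (suc n) − B) (suc m) * Y)     ≈⟨ *-congʳ (natAt (≡.sym (choose-vanish (s≤s n<m)))) ⟩
    keyCoeff (suc n) B (suc m)                    ∎
    where
    n<m = ℕP.≰⇒> m≰n
    Fm = fall (nat n − B) m
    Y = fall B (n ∸ m)

  keySeries-coeff : ∀ n B m → keySeries n B m ≈ keyCoeff n B m
  keySeries-coeff zero B zero = begin
    (om^ 1 ⊛ fallValues 0 B) 0          ≈⟨ ⊛-congʳ {g = fallValues 0 B} (⊛-identityʳ oneMinusX) 0 ⟩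
    (oneMinusX ⊛ fallValues 0 B) 0      ≈⟨ oneMinusX-head (fallValues 0 B) ⟩
    1#                                  ≈⟨ solve 0 (con (+ 1) := (con (+ 1) :+ con (+ 0)) :* (con (+ 1) :* con (+ 1))) refl ⟩
    keyCoeff 0 B 0                      ∎
  keySeries-coeff zero B (suc m) = begin
    (om^ 1 ⊛ fallValues 0 B) (suc m)    ≈⟨ ⊛-congʳ {g = fallValues 0 B} (⊛-identityʳ oneMinusX) (suc m) ⟩
    (oneMinusX ⊛ fallValues 0 B) (suc m) ≈⟨ oneMinusX-step (fallValues 0 B) m ⟩
    1# + - 1#                            ≈⟨ solve 1 (λ x → con (+ 1) :+ :- con (+ 1) := con (+ 0) :* x) refl _ ⟩
    keyCoeff 0 B (suc m)                 ∎
  keySeries-coeff (suc n) B zero = begin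
    keySeries (suc n) B 0                                 ≈⟨ keySeries-rec n B 0 ⟩
    fall B (suc n) * om^ (suc n) 0 + nat (suc n) * 0#     ≈⟨ +-cong (*-congˡ (om^-coeff (suc n) 0)) (zeroʳ _) ⟩
    fall B (suc n) * (1# * (1# + 0#)) + 0#
      ≈⟨ solve 1 (λ x → x :* (con (+ 1) :* (con (+ 1) :+ con (+ 0))) :+ con (+ 0)
                        := (con (+ 1) :+ con (+ 0)) :* (con (+ 1) :* x)) refl _ ⟩
    keyCoeff (suc n) B 0                                  ∎
  keySeries-coeff (suc n) B (suc m) = begin
    keySeries (suc n) B (suc m)                                       ≈⟨ keySeries-rec n B (suc m) ⟩
    fall B (suc n) * om^ (suc n) (suc m) + nat (suc n) * keySeries n B m
      ≈⟨ +-cong (*-congˡ (om^-coeff (suc n) (suc m))) (*-congˡ (keySeries-coeff n B m)) ⟩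
    fall B (suc n) * (sgn (suc m) * nat (choose (suc n) (suc m))) + nat (suc n) * keyCoeff n B m
      ≈⟨ keyCoeff-step n B m ⟩
    keyCoeff (suc n) B (suc m)                                        ∎

  invFact : ℕ → Carrier
  invFact n = nat (n !) ⁻¹

  -- U_n f = (1/n!) (1-x)^{n+1} Σ_m f(m) x^m, because
  -- (1-x)^{n-p} A_p = (1-x)^{n+1} Σ_m m^p x^m.
  U-as-series : ∀ n f → U n f ≋ scale (invFact n) (om^ (suc n) ⊛ (λ m → ev (suc n) f (nat m)))
  U-as-series n f m = begin
    U n f m
      ≈⟨ Σ-cong (suc n) (λ p p≤n → *-congˡ (eulerFactor p p≤n)) ⟩
    Σ< (suc n) (λ p → (f p * invFact n) * (om^ (suc n) ⊛ powers p) m)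
      ≈⟨ sym (Σ-cong′ (suc n) (λ p → ⊛-scaleʳ (om^ (suc n)) (f p * invFact n) (powers p) m)) ⟩
    Σ< (suc n) (λ p → (om^ (suc n) ⊛ scale (f p * invFact n) (powers p)) m)
      ≈⟨ sym (⊛-ΣS (om^ (suc n)) (suc n) (λ p → scale (f p * invFact n) (powers p)) m) ⟩
    (om^ (suc n) ⊛ ΣS< (suc n) (λ p → scale (f p * invFact n) (powers p))) m
      ≈⟨ ⊛-congˡ {f = om^ (suc n)} values m ⟩
    (om^ (suc n) ⊛ scale (invFact n) (λ j → ev (suc n) f (nat j))) m
      ≈⟨ ⊛-scaleʳ (om^ (suc n)) (invFact n) (λ j → ev (suc n) f (nat j)) m ⟩
    invFact n * (om^ (suc n) ⊛ (λ j → ev (suc n) f (nat j))) m ∎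
    where
    powers : ℕ → Ser
    powers p j = pow (nat j) p
    eulerFactor : ∀ p → p < suc n → (om^ (n ∸ p) ⊛ A p) m ≈ (om^ (suc n) ⊛ powers p) m
    eulerFactor p (s≤s p≤n) = begin
      (om^ (n ∸ p) ⊛ (om^ (suc p) ⊛ powers p)) m  ≈⟨ sym (⊛-assoc (om^ (n ∸ p)) (om^ (suc p)) (powers p) m) ⟩
      ((om^ (n ∸ p) ⊛ om^ (suc p)) ⊛ powers p) m  ≈⟨ ⊛-congʳ {g = powers p} (powS-+ oneMinusX (n ∸ p) (suc p)) m ⟩
      (om^ (n ∸ p ℕ.+ suc p) ⊛ powers p) m         ≈⟨ ⊛-congʳ {g = powers p} (powS-index oneMinusX exponent) m ⟩
      (om^ (suc n) ⊛ powers p) m                   ∎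
      where
      exponent : n ∸ p ℕ.+ suc p ≡ suc n
      exponent = ≡.trans (ℕP.+-suc _ p) (≡.cong suc (ℕP.m∸n+n≡m p≤n))
    values : ΣS< (suc n) (λ p → scale (f p * invFact n) (powers p)) ≋ scale (invFact n) (λ j → ev (suc n) f (nat j))
    values j = trans (Σ-cong′ (suc n) (λ i → solve 3 (λ a b c → (a :* b) :* c := b :* (a :* c)) refl _ _ _))
                     (sym (Σ-*ˡ (suc n) (invFact n) _))

  mono-off : ∀ p q → q ≢ p → mono p q ≈ 0#
  mono-off p q q≢p with p ℕ.≟ q
  ... | yes p≡q = ⊥-elim (q≢p (≡.sym p≡q))
  ... | no  _   = refl

  mono-on : ∀ p → mono p p ≈ 1#
  mono-on p with p ℕ.≟ p
  ... | yes _   = refl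
  ... | no  p≢p = ⊥-elim (p≢p ≡.refl)

  Uinv-mono : ∀ n p → p ≤ n → Uinv n (mono p) ≋ (falling p ⊛ rising1 (n ∸ p))
  Uinv-mono n p p≤n m =
    trans (Σ-single (suc n) p (λ q → mono p q * (falling q ⊛ rising1 (n ∸ q)) m) (s≤s p≤n)
                    (λ q _ q≢p → trans (*-congʳ (mono-off p q q≢p)) (zeroˡ _)))
          (trans (*-congʳ (mono-on p)) (*-identityˡ _))

  ev-falling-rising : ∀ p q t → ev (suc p ℕ.+ q) (falling p ⊛ rising1 q) t ≈ fall (t + nat q) (q ℕ.+ p)
  ev-falling-rising p q t = begin
    ev (suc p ℕ.+ q) (falling p ⊛ rising1 q) t
      ≈⟨ LinearProducts.ev-⊛-ΠLin (λ i → nat (suc i)) q (falling p) (suc p) t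
           (LinearProducts.ΠLin-Deg< (λ i → - nat i) p) ⟩
    ev (suc p) (falling p) t * Π< q (λ i → t + nat (suc i))
      ≈⟨ *-cong (LinearProducts.ev-ΠLin (λ i → - nat i) p t) (rising-as-fall t q) ⟩
    fall t p * fall (t + nat q) q                          ≈⟨ *-comm _ _ ⟩
    fall (t + nat q) q * fall t p
      ≈⟨ *-congˡ (fall-cong p (solve 2 (λ t q → t := (t :+ q) :+ :- q) refl _ _)) ⟩
    fall (t + nat q) q * fall ((t + nat q) − nat q) p      ≈⟨ sym (fall-split _ q p) ⟩
    fall (t + nat q) (q ℕ.+ p)                             ∎

  shifted-values : ∀ n p c → p ≤ n → ∀ j →
    ev (suc n) (E c n (Uinv n (mono p))) (nat j) ≈ fallValues n ((c + nat n) − nat p) j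
  shifted-values n p c p≤n j = begin
    ev (suc n) (E c n (Uinv n (mono p))) (nat j)    ≈⟨ ev-E c n (Uinv n (mono p)) (nat j) ⟩
    ev (suc n) (Uinv n (mono p)) t                  ≈⟨ ev-cong (suc n) t (Uinv-mono n p p≤n) ⟩
    ev (suc n) (falling p ⊛ rising1 q) t            ≈⟨ reflexive (≡.cong (λ N → ev N (falling p ⊛ rising1 q) t)
                                                                        (≡.sym (≡.cong suc (ℕP.m+[n∸m]≡n p≤n)))) ⟩
    ev (suc p ℕ.+ q) (falling p ⊛ rising1 q) t      ≈⟨ ev-falling-rising p q t ⟩
    fall (t + nat q) (q ℕ.+ p)                      ≈⟨ reflexive (≡.cong (fall (t + nat q)) (ℕP.m∸n+n≡m p≤n)) ⟩
    fall (t + nat q) n                              ≈⟨ fall-cong n shift ⟩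
    fall (nat j + ((c + nat n) − nat p)) n          ∎
    where
    q = n ∸ p
    t = nat j + c
    shift : t + nat q ≈ nat j + ((c + nat n) − nat p)
    shift = begin
      (nat j + c) + nat q                         ≈⟨ solve 4 (λ j c q p → (j :+ c) :+ q := j :+ ((c :+ (q :+ p)) :+ :- p))
                                                           refl _ _ _ (nat p) ⟩
      nat j + ((c + (nat q + nat p)) − nat p)     ≈⟨ +-congˡ (+-congʳ (+-congˡ (trans (sym (nat-+ q p)) (natAt (ℕP.m∸n+n≡m p≤n))))) ⟩
      nat j + ((c + nat n) − nat p)               ∎

  fact-inverse : ∀ n → nat (n !) * invFact n ≈ 1#
  fact-inverse n = inverseʳ (nat (n !)) (nonzero (n !) {{ℕP._!≢0 n}})
    where
    nonzero : ∀ k → .{{NonZero k}} → ¬ (nat k ≈ 0#)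
    nonzero (suc k) = charZero k

  binomial-coefficients : ∀ n a b m →
    invFact n * (nat (choose n m) * (fall a m * fall b (n ∸ m)))
      ≈ ΣS< (suc n) (λ k → scale (binom a k * binom b (n ∸ k)) (mono k)) m
  binomial-coefficients n a b m with m ℕP.≤? n
  ... | yes m≤n = begin
    i * (C * (X′ * Y))                    ≈⟨ sym (trans (*-congˡ (trans (*-cong (fact-inverse m) (fact-inverse (n ∸ m)))
                                                                          (*-identityˡ _)))
                                                         (*-identityʳ _)) ⟩
    (i * (C * (X′ * Y))) * ((u * invFact m) * (v * invFact (n ∸ m)))
      ≈⟨ solve 8 (λ i C X Y u mi v ri → (i :* (C :* (X :* Y))) :* ((u :* mi) :* (v :* ri))
                                        := (i :* (C :* (u :* v))) :* ((X :* mi) :* (Y :* ri))) refl _ _ _ _ _ _ _ _ ⟩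
    (i * (C * (u * v))) * (binom a m * binom b (n ∸ m))  ≈⟨ *-congʳ (*-congˡ factorials) ⟩
    (i * nat (n !)) * (binom a m * binom b (n ∸ m))      ≈⟨ *-congʳ (trans (*-comm _ _) (fact-inverse n)) ⟩
    1# * (binom a m * binom b (n ∸ m))                   ≈⟨ *-identityˡ _ ⟩
    binom a m * binom b (n ∸ m)                          ≈⟨ sym (trans (*-congˡ (mono-on m)) (*-identityʳ _)) ⟩
    (binom a m * binom b (n ∸ m)) * mono m m
      ≈⟨ sym (Σ-single (suc n) m (λ k → (binom a k * binom b (n ∸ k)) * mono k m) (s≤s m≤n)
                         (λ k _ k≢m → trans (*-congˡ (mono-off k m (λ m≡k → k≢m (≡.sym m≡k)))) (zeroʳ _))) ⟩
    ΣS< (suc n) (λ k → scale (binom a k * binom b (n ∸ k)) (mono k)) m ∎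
    where
    i = invFact n
    C = nat (choose n m)
    X′ = fall a m
    Y = fall b (n ∸ m)
    u = nat (m !)
    v = nat ((n ∸ m) !)
    factorials : C * (u * v) ≈ nat (n !)
    factorials = trans (*-congˡ (sym (nat-* (m !) ((n ∸ m) !))))
                       (trans (sym (nat-* (choose n m) _)) (natAt (choose-factorials n m m≤n)))
  ... | no m≰n = begin
    invFact n * (nat (choose n m) * (fall a m * fall b (n ∸ m)))
      ≈⟨ *-congˡ (*-congʳ (natAt (choose-vanish (ℕP.≰⇒> m≰n)))) ⟩
    invFact n * (0# * (fall a m * fall b (n ∸ m)))   ≈⟨ solve 2 (λ x y → x :* (con (+ 0) :* y) := con (+ 0)) refl _ _ ⟩
    0#                                               ≈⟨ sym (Σ-zero (suc n) (λ k k≤n → trans (*-congˡ (mono-off k m (k≢m k k≤n))) (zeroʳ _))) ⟩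
    ΣS< (suc n) (λ k → scale (binom a k * binom b (n ∸ k)) (mono k)) m ∎
    where
    k≢m : ∀ k → k < suc n → m ≢ k
    k≢m k (s≤s k≤n) m≡k = m≰n (≡.subst (_≤ n) (≡.sym m≡k) k≤n)

  upper-argument : ∀ n c p → nat n − ((c + nat n) − nat p) ≈ (- c) + nat p
  upper-argument n c p = solve 3 (λ n c p → n :+ :- ((c :+ n) :+ :- p) := (:- c) :+ p) refl (nat n) c (nat p)

theorem17 : {c ℓ : Level} (F : CharZeroField c ℓ) →
    let open Poly F in
    (n : ℕ) (β : Carrier) (p : ℕ) → p ≤ n →
    G n β (mono p) ≋
    ΣS< (suc n) (λ m → scale (binom ((- (nat n * β)) + nat p) m
    * binom (((nat n * β) + nat n) − nat p) (n ∸ m)) (mono m))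
theorem17 F n β p p≤n m = begin
  G n β (mono p) m
    ≈⟨ U-as-series n (E cβ n (Uinv n (mono p))) m ⟩
  invFact n * (om^ (suc n) ⊛ (λ j → ev (suc n) (E cβ n (Uinv n (mono p))) (nat j))) m
    ≈⟨ *-congˡ (⊛-congˡ {f = om^ (suc n)} (shifted-values n p cβ p≤n) m) ⟩
  invFact n * keySeries n B m
    ≈⟨ *-congˡ (keySeries-coeff n B m) ⟩
  invFact n * (nat (choose n m) * (fall (nat n − B) m * fall B (n ∸ m)))
    ≈⟨ *-congˡ (*-congˡ (*-congʳ (fall-cong m (upper-argument n cβ p)))) ⟩
  invFact n * (nat (choose n m) * (fall ((- cβ) + nat p) m * fall B (n ∸ m)))
    ≈⟨ binomial-coefficients n ((- cβ) + nat p) B m ⟩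
  ΣS< (suc n) (λ k → scale (binom ((- cβ) + nat p) k * binom B (n ∸ k)) (mono k)) m ∎
  where
  open CharZeroField F hiding (zero)
  open Poly F hiding (Carrier; _+_; _*_; -_)
  open Development F
  open import Relation.Binary.Reasoning.Setoid setoid
  cβ = nat n * β
  B = (cβ + nat n) − nat p
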